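{- For all real $K \geq 1$ we have $F(K) = F_{\mathrm{D}}(K) = F_{\mathrm{SMD}}(K)$.
   Context: For a finite set $I$ of positive integers, $\mathbb{F}_2^I$ denotes the vector space of tuples $(x_i)_{i\in I}$, $x_i\in\mathbb{F}_2$, with standard basis $(e_i)_{i\in I}$; write $x_i$ for the $i$th coordinate of $x$. The doubling constant of a non-empty finite $A$ is $\sigma[A]:=|A+A|/|A|$. A set $A \subseteq \mathbb{F}_2^I$ is a downset if whenever $i \in I$, $x_i = 0$ and $x+e_i \in A$, then $x \in A$. It is shift-minimal if whenever $i<j$ in $I$, $x_i=x_j=0$ and $x+e_j\in A$, then $x+e_i \in A$. A shift-minimal downset is called an SMD. For $K\ge 1$: $F(K)$ is the least constant such that for every finite $I\subseteq \mathbb{Z}_{>0}$ and every non-empty $A\subseteq\mathbb{F}_2^I$ with $\sigma[A]\le K$ there is an affine subspace $V\subseteq \mathbb{F}_2^I$ with $A\subseteq V$ and $|V|\le F(K)|A|$; $F_{\mathrm{D}}(K)$ (resp. $F_{\mathrm{SMD}}(K)$) is defined identically but with $A$ ranging only over non-empty downsets (resp. non-empty SMDs).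
   Formalization: The parameter K and the candidate constants bounding $|V|$ by a multiple of $|A|$, whose least values define $F(K)$, $F_{\mathrm{D}}(K)$ and $F_{\mathrm{SMD}}(K)$, are rational rather than real. -}

module Defs where

open import Data.Bool using (Bool; true; false; _∧_; _xor_; if_then_else_)
open import Data.Nat as ℕ using (ℕ; zero; suc)
open import Data.Fin using (Fin) renaming (_<_ to _<ᶠ_)
open import Data.Vec using (Vec; []; _∷_; lookup; zipWith; replicate; _[_]≔_)
open import Data.List using (List; []; _∷_; map; _++_; filter; length)
open import Data.Bool.ListAction using (any)
open import Data.Bool.Properties using (_≟_)
open import Data.Integer using (+_)
open import Data.Rational using (ℚ; _/_; _*_; _≤_)
open import Data.Product using (Σ; ∃; _×_; _,_)
open import Relation.Binary.PropositionalEquality using (_≡_)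
open import Relation.Unary using (Pred)
open import Level using (0ℓ; suc)

-- Points of F₂^n : vectors of booleans (true = 1).  Coordinates are indexed by
-- Fin n, i.e. the index set I = {1,…,n} (order-preserving relabelling of any
-- finite I ⊆ ℤ_{>0}).
Pt : ℕ → Set
Pt n = Vec Bool n

_⊕_ : ∀ {n} → Pt n → Pt n → Pt n
_⊕_ = zipWith _xor_

𝟎 : ∀ {n} → Pt n
𝟎 = replicate _ false

e : ∀ {n} → Fin n → Pt n
e i = 𝟎 [ i ]≔ true

allPts : (n : ℕ) → List (Pt n)
allPts zero = [] ∷ []
allPts (suc n) = map (false ∷_) (allPts n) ++ map (true ∷_) (allPts n)

FSet : ℕ → Set
FSet n = Pt n → Bool

_∈ₛ_ : ∀ {n} → Pt n → FSet n → Set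
x ∈ₛ A = A x ≡ true

card : ∀ {n} → FSet n → ℕ
card {n} A = length (filter (λ x → A x ≟ true) (allPts n))

sumset : ∀ {n} → FSet n → FSet n
sumset {n} A x = any (λ a → A a ∧ A (a ⊕ x)) (allPts n)

NonEmpty : ∀ {n} → FSet n → Set
NonEmpty A = ∃ λ x → x ∈ₛ A

_⊆ₛ_ : ∀ {n} → FSet n → FSet n → Set
A ⊆ₛ B = ∀ x → x ∈ₛ A → x ∈ₛ B

ℕ→ℚ : ℕ → ℚ
ℕ→ℚ k = + k / 1

-- σ[A] ≤ K, written multiplicatively: |A+A| ≤ K·|A|
-- (equivalent to |A+A|/|A| ≤ K since |A| > 0 for non-empty A)
DoublingAtMost : ∀ {n} → FSet n → ℚ → Set
DoublingAtMost A K = ℕ→ℚ (card (sumset A)) ≤ K * ℕ→ℚ (card A)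

-- linear subspace of F₂^n (over F₂ closure under scalars is automatic)
record IsSubspace {n : ℕ} (W : FSet n) : Set where
  field
    zero∈ : 𝟎 ∈ₛ W
    ⊕-closed : ∀ x y → x ∈ₛ W → y ∈ₛ W → (x ⊕ y) ∈ₛ W

IsAffineSubspace : ∀ {n} → FSet n → Set
IsAffineSubspace {n} V =
  Σ (Pt n) λ v → Σ (FSet n) λ W → IsSubspace W × (∀ x → V x ≡ W (x ⊕ v))

IsDownset : ∀ {n} → FSet n → Set
IsDownset A = ∀ i x → lookup x i ≡ false → (x ⊕ e i) ∈ₛ A → x ∈ₛ A

IsShiftMinimal : ∀ {n} → FSet n → Set
IsShiftMinimal A = ∀ i j x → i <ᶠ j → lookup x i ≡ false → lookup x j ≡ false →
  (x ⊕ e j) ∈ₛ A → (x ⊕ e i) ∈ₛ A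

IsSMD : ∀ {n} → FSet n → Set
IsSMD A = IsDownset A × IsShiftMinimal A

Class : Set₁
Class = ∀ {n} → FSet n → Set

AllSets : Class
AllSets _ = Data.Unit.⊤
  where import Data.Unit

-- C is an admissible constant for doubling K and the class P:
-- every non-empty A in P with σ[A] ≤ K lies in an affine subspace V with |V| ≤ C|A|.
-- F_P(K) is by definition the least admissible C.
Admissible : Class → ℚ → ℚ → Set
Admissible P K C = ∀ (n : ℕ) (A : FSet n) → P A → NonEmpty A → DoublingAtMost A K →
  Σ (FSet n) λ V → IsAffineSubspace V × A ⊆ₛ V × ℕ→ℚ (card V) ≤ C * ℕ→ℚ (card A)

{-# OPTIONS --safe #-}
-- Restricting the class of sets only weakens the requirement, so the content is that a constant
-- admissible for SMDs is admissible for all sets.  Fix a₀ ∈ A and choose greedily a basis of the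
-- span of A ⊕ a₀ inside A ⊕ a₀: in these coordinates A becomes a set B ⊆ F₂^d of the same size
-- and doubling that contains 0 and every e_k, and A lies in an affine subspace of size 2^d.
-- Coordinate compressions (while B is not a downset) and shift compressions (of a downset that
-- is not shift-minimal) preserve |B|, 0 and the e_k, and do not increase |B + B|; each strictly
-- lowers Σ_{x ∈ B} value x, so the process ends at an SMD.  Any affine subspace containing that
-- SMD contains 0 and every e_k, hence is all of F₂^d, of size 2^d.
module Submission where

open import Defs
open import Data.Rational using (ℚ; 1ℚ; _≤_)
open import Data.Product using (_×_)
open import Function.Bundles using (_⇔_; mk⇔)
open import Data.Bool using (Bool; true; false; not; _∧_; _∨_; _xor_; if_then_else_; T)
open import Data.Bool.Properties
  using (xor-comm; xor-assoc; xor-identityˡ; xor-identityʳ; xor-same; not-involutive; ¬-not;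
         ∧-conicalˡ; ∧-conicalʳ; ∧-zeroʳ; ∨-zeroʳ; T-≡)
  renaming (_≟_ to _≟ᵇ_)
open import Data.Bool.ListAction using (any)
open import Data.Empty using (⊥-elim)
open import Data.Unit using (tt)
open import Data.Fin using (Fin; zero; suc; toℕ) renaming (_<_ to _<ᶠ_)
import Data.Fin.Properties as Fin
open import Data.List using (List; []; _∷_; length; filter; map; _++_; allFin)
open import Data.List.Membership.Propositional using (_∈_; lose)
open import Data.List.Membership.Propositional.Properties
  using (∈-filter⁺; ∈-filter⁻; ∈-map⁺; ∈-map⁻; ∈-++⁺ˡ; ∈-++⁺ʳ; ∈-allFin)
open import Data.List.Properties using (length-removeAt′; length-++; length-map; filter-all)
open import Data.List.Relation.Unary.Any using (here; there; _─_; satisfied; any?)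
open import Data.List.Relation.Unary.Any.Properties using (any⁺; any⁻)
open import Data.List.Relation.Unary.All as All using (All)
open import Data.List.Relation.Unary.AllPairs using ([]; _∷_)
open import Data.List.Relation.Unary.Unique.Propositional using (Unique)
import Data.List.Relation.Unary.Unique.Propositional.Properties as Unique
open import Data.Nat using (ℕ; zero; suc; _+_; _*_; _^_; _<ᵇ_; z≤n; s≤s)
  renaming (_≤_ to _≤ℕ_; _<_ to _<ℕ_)
import Data.Nat.Properties as ℕ
import Data.Nat.Coprimality as Coprime
import Data.Integer as ℤ using (+_; +≤+)
import Data.Integer.Properties as ℤ
open import Data.Rational using (*≤*) renaming (_*_ to _*ℚ_)
import Data.Rational.Properties as ℚ
open import Data.Product using (∃; Σ-syntax; ∃-syntax; _,_; proj₁; proj₂)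
open import Data.Sum using (_⊎_; inj₁; inj₂; map₂)
open import Data.Vec using (Vec; []; _∷_; lookup; replicate)
open import Data.Vec.Properties
  using (zipWith-comm; zipWith-assoc; zipWith-identityˡ; zipWith-identityʳ;
         lookup-zipWith; lookup-replicate; lookup∘update; lookup∘update′; ≡-dec)
open import Function using (_∘_; Equivalence)
open import Induction.WellFounded using (Acc; acc)
open import Data.Nat.Induction using (<-wellFounded)
open import Relation.Binary.Definitions using (DecidableEquality)
open import Relation.Binary.PropositionalEquality
open import Relation.Nullary using (¬_; Dec; yes; no)
open import Relation.Nullary.Decidable using (map′; isYes; toWitness; fromWitness)

variable
  n m d : ℕ

infix 4 _≟ₚ_

_≟ₚ_ : DecidableEquality (Pt n)
_≟ₚ_ = ≡-dec _≟ᵇ_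

⊕-comm : (x y : Pt n) → x ⊕ y ≡ y ⊕ x
⊕-comm = zipWith-comm xor-comm

⊕-assoc : (x y z : Pt n) → (x ⊕ y) ⊕ z ≡ x ⊕ (y ⊕ z)
⊕-assoc = zipWith-assoc xor-assoc

⊕-identityˡ : (x : Pt n) → 𝟎 ⊕ x ≡ x
⊕-identityˡ = zipWith-identityˡ xor-identityˡ

⊕-identityʳ : (x : Pt n) → x ⊕ 𝟎 ≡ x
⊕-identityʳ = zipWith-identityʳ xor-identityʳ

⊕-self : (x : Pt n) → x ⊕ x ≡ 𝟎
⊕-self []      = refl
⊕-self (a ∷ x) = cong₂ _∷_ (xor-same a) (⊕-self x)

⊕-cancelʳ : (x u : Pt n) → (x ⊕ u) ⊕ u ≡ x
⊕-cancelʳ x u = begin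
  (x ⊕ u) ⊕ u  ≡⟨ ⊕-assoc x u u ⟩
  x ⊕ (u ⊕ u)  ≡⟨ cong (x ⊕_) (⊕-self u) ⟩
  x ⊕ 𝟎        ≡⟨ ⊕-identityʳ x ⟩
  x            ∎
  where open ≡-Reasoning

⊕-cancelˡ : (u x : Pt n) → u ⊕ (u ⊕ x) ≡ x
⊕-cancelˡ u x = trans (sym (⊕-assoc u u x)) (trans (cong (_⊕ x) (⊕-self u)) (⊕-identityˡ x))

⊕-injectiveʳ : (u : Pt n) {x y : Pt n} → x ⊕ u ≡ y ⊕ u → x ≡ y
⊕-injectiveʳ u {x} {y} eq = trans (sym (⊕-cancelʳ x u)) (trans (cong (_⊕ u) eq) (⊕-cancelʳ y u))

⊕-moveʳ : (u : Pt n) {x y : Pt n} → x ⊕ u ≡ y → x ≡ y ⊕ u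
⊕-moveʳ u {x} eq = trans (sym (⊕-cancelʳ x u)) (cong (_⊕ u) eq)

⊕-swapʳ : (x y z : Pt n) → (x ⊕ y) ⊕ z ≡ (x ⊕ z) ⊕ y
⊕-swapʳ x y z = begin
  (x ⊕ y) ⊕ z  ≡⟨ ⊕-assoc x y z ⟩
  x ⊕ (y ⊕ z)  ≡⟨ cong (x ⊕_) (⊕-comm y z) ⟩
  x ⊕ (z ⊕ y)  ≡⟨ ⊕-assoc x z y ⟨
  (x ⊕ z) ⊕ y  ∎
  where open ≡-Reasoning

⊕-interchange : (p q r s : Pt n) → (p ⊕ q) ⊕ (r ⊕ s) ≡ (p ⊕ r) ⊕ (q ⊕ s)
⊕-interchange p q r s = begin
  (p ⊕ q) ⊕ (r ⊕ s)  ≡⟨ ⊕-assoc (p ⊕ q) r s ⟨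
  ((p ⊕ q) ⊕ r) ⊕ s  ≡⟨ cong (_⊕ s) (⊕-swapʳ p q r) ⟩
  ((p ⊕ r) ⊕ q) ⊕ s  ≡⟨ ⊕-assoc (p ⊕ r) q s ⟩
  (p ⊕ r) ⊕ (q ⊕ s)  ∎
  where open ≡-Reasoning

⊕-cancel-both : (x y u : Pt n) → (x ⊕ u) ⊕ (y ⊕ u) ≡ x ⊕ y
⊕-cancel-both x y u = begin
  (x ⊕ u) ⊕ (y ⊕ u)  ≡⟨ ⊕-interchange x u y u ⟩
  (x ⊕ y) ⊕ (u ⊕ u)  ≡⟨ cong ((x ⊕ y) ⊕_) (⊕-self u) ⟩
  (x ⊕ y) ⊕ 𝟎        ≡⟨ ⊕-identityʳ (x ⊕ y) ⟩
  x ⊕ y              ∎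
  where open ≡-Reasoning

lookup-⊕ : (x y : Pt n) (i : Fin n) → lookup (x ⊕ y) i ≡ lookup x i xor lookup y i
lookup-⊕ x y i = lookup-zipWith _xor_ i x y

lookup-𝟎 : (i : Fin n) → lookup 𝟎 i ≡ false
lookup-𝟎 i = lookup-replicate i false

lookup-e-same : (i : Fin n) → lookup (e i) i ≡ true
lookup-e-same i = lookup∘update i 𝟎 true

lookup-e-other : {i j : Fin n} → i ≢ j → lookup (e j) i ≡ false
lookup-e-other {i = i} i≢j = trans (lookup∘update′ i≢j 𝟎 true) (lookup-𝟎 i)

lookup-flip-same : (x : Pt n) (i : Fin n) → lookup (x ⊕ e i) i ≡ not (lookup x i)
lookup-flip-same x i rewrite lookup-⊕ x (e i) i | lookup-e-same i with lookup x i
... | true  = refl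
... | false = refl

lookup-flip-other : (x : Pt n) {i j : Fin n} → i ≢ j → lookup (x ⊕ e j) i ≡ lookup x i
lookup-flip-other x {i} {j} i≢j
  rewrite lookup-⊕ x (e j) i | lookup-e-other i≢j = xor-identityʳ (lookup x i)

true≢false : true ≢ false
true≢false ()

∨-true⁻ : {a b : Bool} → a ∨ b ≡ true → a ≡ true ⊎ b ≡ true
∨-true⁻ {true}  _ = inj₁ refl
∨-true⁻ {false} p = inj₂ p

not-true⇒false : {b : Bool} → not b ≡ true → b ≡ false
not-true⇒false {false} _ = refl

allPts-complete : (x : Pt n) → x ∈ allPts n
allPts-complete []          = here refl
allPts-complete (false ∷ x) = ∈-++⁺ˡ (∈-map⁺ (false ∷_) (allPts-complete x))
allPts-complete (true ∷ x)  = ∈-++⁺ʳ _ (∈-map⁺ (true ∷_) (allPts-complete x))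

allPts-unique : (n : ℕ) → Unique (allPts n)
allPts-unique zero    = All.[] ∷ []
allPts-unique (suc n) =
  Unique.++⁺ (Unique.map⁺ ∷-injectiveʳ (allPts-unique n))
             (Unique.map⁺ ∷-injectiveʳ (allPts-unique n)) heads-differ
  where
  ∷-injectiveʳ : {b : Bool} {x y : Pt n} → b ∷ x ≡ b ∷ y → x ≡ y
  ∷-injectiveʳ refl = refl
  heads-differ : {z : Pt (suc n)} → ¬ (z ∈ map (false ∷_) (allPts n) × z ∈ map (true ∷_) (allPts n))
  heads-differ (p , q) with ∈-map⁻ (false ∷_) p | ∈-map⁻ (true ∷_) q
  ... | _ , _ , refl | _ , _ , ()

members : FSet n → List (Pt n)
members {n} A = filter (λ x → A x ≟ᵇ true) (allPts n)

members⁺ : (A : FSet n) {x : Pt n} → x ∈ₛ A → x ∈ members A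
members⁺ A {x} = ∈-filter⁺ (λ x → A x ≟ᵇ true) (allPts-complete x)

members⁻ : (A : FSet n) {x : Pt n} → x ∈ members A → x ∈ₛ A
members⁻ {n} A p = proj₂ (∈-filter⁻ (λ x → A x ≟ᵇ true) {xs = allPts n} p)

members-unique : (A : FSet n) → Unique (members A)
members-unique {n} A = Unique.filter⁺ (λ x → A x ≟ᵇ true) (allPts-unique n)

∈-─ : {A : Set} {y z : A} {ys : List A} (p : y ∈ ys) → z ∈ ys → z ≢ y → z ∈ (ys ─ p)
∈-─ (here refl) (here refl) z≢y = ⊥-elim (z≢y refl)
∈-─ (here refl) (there q)   _   = q
∈-─ (there p)   (here refl) _   = here refl
∈-─ (there p)   (there q)   z≢y = there (∈-─ p q z≢y)

length-≤-injection : {A B : Set} {xs : List A} {ys : List B} (f : A → B) → Unique xs →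
  (∀ {x x′} → x ∈ xs → x′ ∈ xs → f x ≡ f x′ → x ≡ x′) →
  (∀ {x} → x ∈ xs → f x ∈ ys) →
  length xs ≤ℕ length ys
length-≤-injection {xs = []}     f _            _   _    = z≤n
length-≤-injection {xs = x ∷ xs} {ys} f (x∉xs ∷ unique) inj into = begin
  suc (length xs)            ≤⟨ s≤s (length-≤-injection f unique (λ p q → inj (there p) (there q)) into′) ⟩
  suc (length (ys ─ fx∈ys))  ≡⟨ length-removeAt′ ys _ ⟨
  length ys                  ∎
  where
  open ℕ.≤-Reasoning
  fx∈ys : f x ∈ ys
  fx∈ys = into (here refl)
  into′ : ∀ {x′} → x′ ∈ xs → f x′ ∈ (ys ─ fx∈ys)
  into′ p = ∈-─ fx∈ys (into (there p)) λ eq → All.lookup x∉xs p (inj (here refl) (there p) (sym eq))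

MapsTo : (Pt n → Pt m) → FSet n → FSet m → Set
MapsTo f X Y = ∀ x → x ∈ₛ X → f x ∈ₛ Y

InjectiveOn : (Pt n → Pt m) → FSet n → Set
InjectiveOn f X = ∀ x y → x ∈ₛ X → y ∈ₛ X → f x ≡ f y → x ≡ y

module _ {X : FSet n} {Y : FSet m} (f : Pt n → Pt m) (into : MapsTo f X Y) (inj : InjectiveOn f X) where

  private
    members-injective : ∀ {x x′} → x ∈ members X → x′ ∈ members X → f x ≡ f x′ → x ≡ x′
    members-injective p q = inj _ _ (members⁻ X p) (members⁻ X q)

    members-into : ∀ {x} → x ∈ members X → f x ∈ members Y
    members-into p = members⁺ Y (into _ (members⁻ X p))

  card-≤-injection : card X ≤ℕ card Y
  card-≤-injection = length-≤-injection f (members-unique X) members-injective members-into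

  card-<-injection : (y : Pt m) → y ∈ₛ Y → (∀ x → x ∈ₛ X → f x ≢ y) → card X <ℕ card Y
  card-<-injection y y∈Y missed = begin-strict
    card X                           <⟨ s≤s (length-≤-injection f (members-unique X)
                                                                    members-injective into′) ⟩
    suc (length (members Y ─ y∈ys))  ≡⟨ length-removeAt′ (members Y) _ ⟨
    card Y                           ∎
    where
    open ℕ.≤-Reasoning
    y∈ys : y ∈ members Y
    y∈ys = members⁺ Y y∈Y
    into′ : ∀ {x} → x ∈ members X → f x ∈ (members Y ─ y∈ys)
    into′ p = ∈-─ y∈ys (members-into p) (missed _ (members⁻ X p))

module _ {X : Set} {P Q : X → Set} (P⊎Q : ∀ x → P x ⊎ Q x) where

  search-list : (xs : List X) → (∀ x → x ∈ xs → P x) ⊎ ∃ Q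
  search-list []       = inj₁ λ _ ()
  search-list (x ∷ xs) with P⊎Q x | search-list xs
  ... | inj₂ qx | _           = inj₂ (x , qx)
  ... | inj₁ _  | inj₂ found  = inj₂ found
  ... | inj₁ px | inj₁ all-P  = inj₁ λ where
    _ (here refl) → px
    y (there y∈xs) → all-P y y∈xs

  search : (xs : List X) → (∀ x → x ∈ xs) → (∀ x → P x) ⊎ ∃ Q
  search xs complete with search-list xs
  ... | inj₁ all-P = inj₁ λ x → all-P x (complete x)
  ... | inj₂ found = inj₂ found

search-Pt : {P Q : Pt n → Set} → (∀ x → P x ⊎ Q x) → (∀ x → P x) ⊎ ∃ Q
search-Pt P⊎Q = search P⊎Q (allPts _) allPts-complete

search-Fin : {P Q : Fin n → Set} → (∀ i → P i ⊎ Q i) → (∀ i → P i) ⊎ ∃ Q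
search-Fin P⊎Q = search P⊎Q (allFin _) ∈-allFin

∃-Pt? : {P : Pt n → Set} → (∀ x → Dec (P x)) → Dec (∃ P)
∃-Pt? P? = map′ satisfied (λ (x , px) → lose (allPts-complete x) px) (any? P? (allPts _))

sumset⁻ : (A : FSet n) {z : Pt n} → z ∈ₛ sumset A → ∃[ a ] ∃[ b ] a ∈ₛ A × b ∈ₛ A × a ⊕ b ≡ z
sumset⁻ {n} A {z} z∈A+A
  with a , Ta ← satisfied (any⁻ _ (allPts n) (Equivalence.from T-≡ z∈A+A))
  with h ← Equivalence.to T-≡ Ta
  = a , a ⊕ z , ∧-conicalˡ _ _ h , ∧-conicalʳ _ _ h , ⊕-cancelˡ a z

sumset⁺ : (A : FSet n) {a b z : Pt n} → a ∈ₛ A → b ∈ₛ A → a ⊕ b ≡ z → z ∈ₛ sumset A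
sumset⁺ {n} A {a} {b} a∈A b∈A refl = Equivalence.to T-≡ (any⁺ _ (lose (allPts-complete a) a-works))
  where
  a-works : T (A a ∧ A (a ⊕ (a ⊕ b)))
  a-works rewrite a∈A | ⊕-cancelˡ a b | b∈A = _

module _ (A : FSet n) (u : Pt n) where

  sumset-cover : ∀ a b → a ∈ₛ A ⊎ (a ⊕ u) ∈ₛ A → b ∈ₛ A ⊎ (b ⊕ u) ∈ₛ A →
    (a ⊕ b) ∈ₛ sumset A ⊎ ((a ⊕ b) ⊕ u) ∈ₛ sumset A
  sumset-cover a b (inj₁ a∈A)   (inj₁ b∈A)   = inj₁ (sumset⁺ A a∈A b∈A refl)
  sumset-cover a b (inj₁ a∈A)   (inj₂ b⊕u∈A) = inj₂ (sumset⁺ A a∈A b⊕u∈A (sym (⊕-assoc a b u)))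
  sumset-cover a b (inj₂ a⊕u∈A) (inj₁ b∈A)   = inj₂ (sumset⁺ A a⊕u∈A b∈A (⊕-swapʳ a u b))
  sumset-cover a b (inj₂ a⊕u∈A) (inj₂ b⊕u∈A) = inj₁ (sumset⁺ A a⊕u∈A b⊕u∈A (⊕-cancel-both a b u))

  sumset-doubled : ∀ a b → a ∈ₛ A × (a ⊕ u) ∈ₛ A → b ∈ₛ A ⊎ (b ⊕ u) ∈ₛ A →
    (a ⊕ b) ∈ₛ sumset A × ((a ⊕ b) ⊕ u) ∈ₛ sumset A
  sumset-doubled a b (a∈A , a⊕u∈A) (inj₁ b∈A) =
    sumset⁺ A a∈A b∈A refl , sumset⁺ A a⊕u∈A b∈A (⊕-swapʳ a u b)
  sumset-doubled a b (a∈A , a⊕u∈A) (inj₂ b⊕u∈A) =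
    sumset⁺ A a⊕u∈A b⊕u∈A (⊕-cancel-both a b u) , sumset⁺ A a∈A b⊕u∈A (sym (⊕-assoc a b u))

one-of-four-set : {a b c d u : Pt n} (k : Fin n) → lookup u k ≡ true → c ⊕ d ≡ (a ⊕ b) ⊕ u →
  lookup a k ≡ true ⊎ lookup b k ≡ true ⊎ lookup c k ≡ true ⊎ lookup d k ≡ true
one-of-four-set {a = a} {b} {c} {d} {u} k u-k c⊕d≡a⊕b⊕u = parity _ _ _ _ (begin
  lookup c k xor lookup d k                   ≡⟨ lookup-⊕ c d k ⟨
  lookup (c ⊕ d) k                            ≡⟨ cong (λ w → lookup w k) c⊕d≡a⊕b⊕u ⟩
  lookup ((a ⊕ b) ⊕ u) k                      ≡⟨ lookup-⊕ (a ⊕ b) u k ⟩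
  lookup (a ⊕ b) k xor lookup u k             ≡⟨ cong₂ _xor_ (lookup-⊕ a b k) u-k ⟩
  (lookup a k xor lookup b k) xor true        ∎)
  where
  open ≡-Reasoning
  parity : ∀ a b c d → c xor d ≡ (a xor b) xor true → a ≡ true ⊎ b ≡ true ⊎ c ≡ true ⊎ d ≡ true
  parity true  _     _     _     _  = inj₁ refl
  parity false true  _     _     _  = inj₂ (inj₁ refl)
  parity false false true  _     _  = inj₂ (inj₂ (inj₁ refl))
  parity false false false true  _  = inj₂ (inj₂ (inj₂ refl))
  parity false false false false ()

bit : Bool → ℕ
bit b = if b then 1 else 0

value : Pt n → ℕ
value []      = 0
value (b ∷ x) = bit b + 2 * value x

value-< : (x : Pt n) → value x <ℕ 2 ^ n
value-< []              = s≤s z≤n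
value-< {suc n} (b ∷ x) = begin-strict
  bit b + 2 * value x  ≤⟨ ℕ.+-monoˡ-≤ (2 * value x) (bit≤1 b) ⟩
  1 + 2 * value x      <⟨ ℕ.n<1+n _ ⟩
  2 + 2 * value x      ≡⟨ ℕ.*-suc 2 (value x) ⟨
  2 * suc (value x)    ≤⟨ ℕ.*-monoʳ-≤ 2 (value-< x) ⟩
  2 * 2 ^ n            ∎
  where
  open ℕ.≤-Reasoning
  bit≤1 : ∀ b → bit b ≤ℕ 1
  bit≤1 true  = s≤s z≤n
  bit≤1 false = z≤n

value-flip : (x : Pt n) (i : Fin n) → lookup x i ≡ false → value (x ⊕ e i) ≡ value x + 2 ^ toℕ i
value-flip (false ∷ x) zero    refl rewrite ⊕-identityʳ x = ℕ.+-comm 1 (2 * value x)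
value-flip (b ∷ x)     (suc i) xᵢ rewrite xor-identityʳ b | value-flip x i xᵢ = begin
  bit b + 2 * (value x + 2 ^ toℕ i)        ≡⟨ cong (bit b +_) (ℕ.*-distribˡ-+ 2 (value x) (2 ^ toℕ i)) ⟩
  bit b + (2 * value x + 2 * 2 ^ toℕ i)    ≡⟨ ℕ.+-assoc (bit b) (2 * value x) _ ⟨
  bit b + 2 * value x + 2 * 2 ^ toℕ i      ∎
  where open ≡-Reasoning

above : FSet n → ℕ → FSet n
above A m x = A x ∧ (m <ᵇ value x)

above⁺ : (A : FSet n) (m : ℕ) (x : Pt n) → x ∈ₛ A → m <ℕ value x → x ∈ₛ above A m
above⁺ A m x x∈A m<x rewrite x∈A = Equivalence.to T-≡ (ℕ.<⇒<ᵇ m<x)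

above⁻ : (A : FSet n) (m : ℕ) (x : Pt n) → x ∈ₛ above A m → x ∈ₛ A × m <ℕ value x
above⁻ A m x h = ∧-conicalˡ _ _ h , ℕ.<ᵇ⇒< _ _ (Equivalence.from T-≡ (∧-conicalʳ _ _ h))

∑< : ℕ → (ℕ → ℕ) → ℕ
∑< zero    f = 0
∑< (suc M) f = f M + ∑< M f

∑<-mono-≤ : {f g : ℕ → ℕ} (M : ℕ) → (∀ m → f m ≤ℕ g m) → ∑< M f ≤ℕ ∑< M g
∑<-mono-≤ zero    f≤g = z≤n
∑<-mono-≤ (suc M) f≤g = ℕ.+-mono-≤ (f≤g M) (∑<-mono-≤ M f≤g)

∑<-mono-< : {f g : ℕ → ℕ} {M m₀ : ℕ} → (∀ m → f m ≤ℕ g m) → m₀ <ℕ M → f m₀ <ℕ g m₀ →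
  ∑< M f <ℕ ∑< M g
∑<-mono-< {M = suc M} {m₀} f≤g m₀<M fm₀<gm₀ with m₀ ℕ.≟ M
... | yes refl = ℕ.+-mono-<-≤ fm₀<gm₀ (∑<-mono-≤ M f≤g)
... | no m₀≢M  = ℕ.+-mono-≤-< (f≤g M) (∑<-mono-< f≤g (ℕ.≤∧≢⇒< (ℕ.≤-pred m₀<M) m₀≢M) fm₀<gm₀)

-- Σ_{x ∈ A} value x, written as Σ_m |{x ∈ A : value x > m}| so that each term can be
-- compared by pairwise domination.
weight : FSet n → ℕ
weight {n} A = ∑< (2 ^ n) (λ m → card (above A m))

-- |X ∩ {x, x ⊕ u}| ≤ |Y ∩ {x, x ⊕ u}| for every x.
record PairwiseDominated (u : Pt n) (X Y : FSet n) : Set where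
  field
    cover : ∀ x → x ∈ₛ X → x ∈ₛ Y ⊎ (x ⊕ u) ∈ₛ Y
    pair  : ∀ x → x ∈ₛ X → (x ⊕ u) ∈ₛ X → x ∈ₛ Y

module _ {u : Pt n} {X Y : FSet n} (X≼Y : PairwiseDominated u X Y) where
  open PairwiseDominated X≼Y

  private
    move : Pt n → Pt n
    move x = if Y x then x else x ⊕ u

    move-into : MapsTo move X Y
    move-into x x∈X with Y x in Yx | cover x x∈X
    ... | true  | _          = Yx
    ... | false | inj₂ x⊕u∈Y = x⊕u∈Y

    no-jump-onto : ∀ {x x′} → x ∈ₛ X → x′ ∈ₛ X → Y x′ ≡ false → x ≢ x′ ⊕ u
    no-jump-onto x∈X x′∈X x′∉Y refl = true≢false (trans (sym (pair _ x′∈X x∈X)) x′∉Y)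

    move-injective : InjectiveOn move X
    move-injective x x′ x∈X x′∈X eq with Y x in Yx | Y x′ in Yx′
    ... | true  | true  = eq
    ... | true  | false = ⊥-elim (no-jump-onto x∈X x′∈X Yx′ eq)
    ... | false | true  = ⊥-elim (no-jump-onto x′∈X x∈X Yx (sym eq))
    ... | false | false = ⊕-injectiveʳ u eq

  card-mono-dominated : card X ≤ℕ card Y
  card-mono-dominated = card-≤-injection move move-into move-injective

  card-strict-dominated : (y : Pt n) → y ∈ₛ Y → X y ≡ false → ((y ⊕ u) ∈ₛ X → (y ⊕ u) ∈ₛ Y) →
    card X <ℕ card Y
  card-strict-dominated y y∈Y y∉X y⊕u-kept =
    card-<-injection move move-into move-injective y y∈Y missed
    where
    missed : ∀ x → x ∈ₛ X → move x ≢ y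
    missed x x∈X eq with Y x in Yx
    ... | true  = true≢false (trans (sym x∈X) (trans (cong X eq) y∉X))
    ... | false = true≢false (trans (sym x∈Y) Yx)
      where
      x≡y⊕u : x ≡ y ⊕ u
      x≡y⊕u = ⊕-moveʳ u eq
      x∈Y : x ∈ₛ Y
      x∈Y = subst (_∈ₛ Y) (sym x≡y⊕u) (y⊕u-kept (subst (_∈ₛ X) x≡y⊕u x∈X))

-- On each coset {x, x ⊕ u} with x lower (so x ⊕ u upper) the points of A are pushed to x.
record Compression (n : ℕ) : Set where
  field
    u            : Pt n
    lower upper  : FSet n
    upper-⊕      : ∀ x → upper (x ⊕ u) ≡ lower x
    lower⇒¬upper : ∀ x → lower x ≡ true → upper x ≡ false

  compress : FSet n → FSet n
  compress A x = if lower x then A x ∨ A (x ⊕ u) else if upper x then A x ∧ A (x ⊕ u) else A x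

  lower-⊕ : ∀ x → lower (x ⊕ u) ≡ upper x
  lower-⊕ x = trans (sym (upper-⊕ (x ⊕ u))) (cong upper (⊕-cancelʳ x u))

  upper⇒¬lower : ∀ {x} → upper x ≡ true → lower x ≡ false
  upper⇒¬lower {x} ux with lower x in lx
  ... | true  = trans (sym ux) (lower⇒¬upper x lx)
  ... | false = refl

  data Position (x : Pt n) : Set where
    low  : lower x ≡ true → Position x
    high : upper x ≡ true → Position x
    rest : lower x ≡ false → upper x ≡ false → Position x

  position : ∀ x → Position x
  position x with lower x in lx | upper x in ux
  ... | true  | _     = low lx
  ... | false | true  = high ux
  ... | false | false = rest lx ux

  module _ (A : FSet n) where

    compress-low : ∀ {x} → lower x ≡ true → compress A x ≡ A x ∨ A (x ⊕ u)
    compress-low lx rewrite lx = refl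

    compress-high : ∀ {x} → upper x ≡ true → compress A x ≡ A x ∧ A (x ⊕ u)
    compress-high ux rewrite upper⇒¬lower ux | ux = refl

    compress-rest : ∀ {x} → lower x ≡ false → upper x ≡ false → compress A x ≡ A x
    compress-rest lx ux rewrite lx | ux = refl

    compress⁻ : ∀ x → x ∈ₛ compress A → x ∈ₛ A ⊎ (lower x ≡ true × (x ⊕ u) ∈ₛ A)
    compress⁻ x x∈C with position x
    ... | low lx with ∨-true⁻ (trans (sym (compress-low lx)) x∈C)
    ...   | inj₁ x∈A   = inj₁ x∈A
    ...   | inj₂ x⊕u∈A = inj₂ (lx , x⊕u∈A)
    compress⁻ x x∈C | high ux  = inj₁ (∧-conicalˡ _ _ (trans (sym (compress-high ux)) x∈C))
    compress⁻ x x∈C | rest lx ux = inj₁ (trans (sym (compress-rest lx ux)) x∈C)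

    compress-both⁻ : ∀ x → x ∈ₛ compress A → (x ⊕ u) ∈ₛ compress A → x ∈ₛ A
    compress-both⁻ x x∈C x⊕u∈C with position x
    ... | low lx     = subst (_∈ₛ A) (⊕-cancelʳ x u)
                         (∧-conicalʳ _ _ (trans (sym (compress-high (trans (upper-⊕ x) lx))) x⊕u∈C))
    ... | high ux    = ∧-conicalˡ _ _ (trans (sym (compress-high ux)) x∈C)
    ... | rest lx ux = trans (sym (compress-rest lx ux)) x∈C

    compress⁺ : ∀ x → x ∈ₛ A → x ∈ₛ compress A ⊎ (x ⊕ u) ∈ₛ compress A
    compress⁺ x x∈A with position x
    ... | low lx     = inj₁ (trans (compress-low lx) (cong (_∨ A (x ⊕ u)) x∈A))
    ... | high ux    = inj₂ (trans (compress-low (trans (lower-⊕ x) ux))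
                              (trans (cong (A (x ⊕ u) ∨_) (trans (cong A (⊕-cancelʳ x u)) x∈A))
                                     (∨-zeroʳ _)))
    ... | rest lx ux = inj₁ (trans (compress-rest lx ux) x∈A)

    compress-both⁺ : ∀ x → x ∈ₛ A → (x ⊕ u) ∈ₛ A → x ∈ₛ compress A
    compress-both⁺ x x∈A x⊕u∈A with position x
    ... | low lx     = trans (compress-low lx) (cong (_∨ A (x ⊕ u)) x∈A)
    ... | high ux    = trans (compress-high ux) (cong₂ _∧_ x∈A x⊕u∈A)
    ... | rest lx ux = trans (compress-rest lx ux) x∈A

    compress-keeps : ∀ x → x ∈ₛ A → upper x ≡ false → x ∈ₛ compress A
    compress-keeps x x∈A ux with position x
    ... | low lx      = trans (compress-low lx) (cong (_∨ A (x ⊕ u)) x∈A)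
    ... | high ux′    = ⊥-elim (true≢false (trans (sym ux′) ux))
    ... | rest lx ux′ = trans (compress-rest lx ux′) x∈A

    compress-dominated : PairwiseDominated u (compress A) A
    compress-dominated = record
      { cover = λ x x∈C → map₂ proj₂ (compress⁻ x x∈C)
      ; pair  = compress-both⁻ }

    dominated-compress : PairwiseDominated u A (compress A)
    dominated-compress = record { cover = compress⁺ ; pair = compress-both⁺ }

    card-compress : card (compress A) ≡ card A
    card-compress = ℕ.≤-antisym (card-mono-dominated compress-dominated)
                                (card-mono-dominated dominated-compress)

    module _ (k : Fin n) (u-k : lookup u k ≡ true)
             (doubled : ∀ a → a ∈ₛ compress A → lookup a k ≡ true → a ∈ₛ A × (a ⊕ u) ∈ₛ A) where

      -- If z and z ⊕ u are both sums from compress A then, as u has k-th coordinate 1, one of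
      -- the four summands has k-th coordinate 1, hence is doubled in A, and z ∈ A + A.
      sumset-compress-dominated : PairwiseDominated u (sumset (compress A)) (sumset A)
      sumset-compress-dominated = record { cover = cover ; pair = pair }
        where
        partner : ∀ a → a ∈ₛ compress A → a ∈ₛ A ⊎ (a ⊕ u) ∈ₛ A
        partner = PairwiseDominated.cover compress-dominated

        cover : ∀ z → z ∈ₛ sumset (compress A) → z ∈ₛ sumset A ⊎ (z ⊕ u) ∈ₛ sumset A
        cover z z∈C+C with sumset⁻ (compress A) z∈C+C
        ... | a , b , a∈C , b∈C , refl = sumset-cover A u a b (partner a a∈C) (partner b b∈C)

        pair : ∀ z → z ∈ₛ sumset (compress A) → (z ⊕ u) ∈ₛ sumset (compress A) → z ∈ₛ sumset A
        pair z z∈C+C z⊕u∈C+C with sumset⁻ (compress A) z∈C+C | sumset⁻ (compress A) z⊕u∈C+C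
        ... | a , b , a∈C , b∈C , refl | c , d , c∈C , d∈C , c⊕d≡z⊕u
            with one-of-four-set k u-k c⊕d≡z⊕u
        ... | inj₁ aₖ =
              proj₁ (sumset-doubled A u a b (doubled a a∈C aₖ) (partner b b∈C))
        ... | inj₂ (inj₁ bₖ) = subst (_∈ₛ sumset A) (⊕-comm b a)
              (proj₁ (sumset-doubled A u b a (doubled b b∈C bₖ) (partner a a∈C)))
        ... | inj₂ (inj₂ (inj₁ cₖ)) = subst (_∈ₛ sumset A) c⊕d⊕u≡z
              (proj₂ (sumset-doubled A u c d (doubled c c∈C cₖ) (partner d d∈C)))
          where
          c⊕d⊕u≡z : (c ⊕ d) ⊕ u ≡ a ⊕ b
          c⊕d⊕u≡z = sym (⊕-moveʳ u (sym c⊕d≡z⊕u))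
        ... | inj₂ (inj₂ (inj₂ dₖ)) = subst (_∈ₛ sumset A) d⊕c⊕u≡z
              (proj₂ (sumset-doubled A u d c (doubled d d∈C dₖ) (partner c c∈C)))
          where
          d⊕c⊕u≡z : (d ⊕ c) ⊕ u ≡ a ⊕ b
          d⊕c⊕u≡z = sym (⊕-moveʳ u (trans (sym c⊕d≡z⊕u) (⊕-comm c d)))

      card-sumset-compress : card (sumset (compress A)) ≤ℕ card (sumset A)
      card-sumset-compress = card-mono-dominated sumset-compress-dominated

    module _ (lower-value-< : ∀ x → lower x ≡ true → value x <ℕ value (x ⊕ u)) where

      above-compress-dominated : ∀ m → PairwiseDominated u (above (compress A) m) (above A m)
      above-compress-dominated m = record { cover = cover ; pair = pair }
        where
        cover : ∀ x → x ∈ₛ above (compress A) m → x ∈ₛ above A m ⊎ (x ⊕ u) ∈ₛ above A m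
        cover x x∈ with above⁻ (compress A) m x x∈
        ... | x∈C , m<x with compress⁻ x x∈C
        ...   | inj₁ x∈A          = inj₁ (above⁺ A m x x∈A m<x)
        ...   | inj₂ (lx , x⊕u∈A) = inj₂ (above⁺ A m (x ⊕ u) x⊕u∈A (ℕ.<-trans m<x (lower-value-< x lx)))

        pair : ∀ x → x ∈ₛ above (compress A) m → (x ⊕ u) ∈ₛ above (compress A) m → x ∈ₛ above A m
        pair x x∈ x⊕u∈ with above⁻ (compress A) m x x∈ | above⁻ (compress A) m (x ⊕ u) x⊕u∈
        ... | x∈C , m<x | x⊕u∈C , _ = above⁺ A m x (compress-both⁻ x x∈C x⊕u∈C) m<x

      -- The strict decrease happens at the threshold value (y ⊕ u), where y is counted for A
      -- but not for compress A.
      weight-compress-< : ∀ y → y ∈ₛ A → upper y ≡ true → A (y ⊕ u) ≡ false →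
        weight (compress A) <ℕ weight A
      weight-compress-< y y∈A uy y⊕u∉A =
        ∑<-mono-< (λ m → card-mono-dominated (above-compress-dominated m))
          (ℕ.<-trans m₀<y (value-< y))
          (card-strict-dominated (above-compress-dominated m₀) y (above⁺ A m₀ y y∈A m₀<y) y∉C
            (λ y⊕u∈ → ⊥-elim (ℕ.<-irrefl refl (proj₂ (above⁻ (compress A) m₀ (y ⊕ u) y⊕u∈)))))
        where
        m₀ : ℕ
        m₀ = value (y ⊕ u)
        m₀<y : m₀ <ℕ value y
        m₀<y = subst (λ w → m₀ <ℕ value w) (⊕-cancelʳ y u)
                 (lower-value-< (y ⊕ u) (trans (lower-⊕ y) uy))
        y∉C : above (compress A) m₀ y ≡ false
        y∉C rewrite compress-high uy | y∈A | y⊕u∉A = refl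

Spanning : FSet n → Set
Spanning B = 𝟎 ∈ₛ B × (∀ k → e k ∈ₛ B)

record _≼_ (B : FSet m) (A : FSet n) : Set where
  field
    card-≡   : card B ≡ card A
    sumset-≤ : card (sumset B) ≤ℕ card (sumset A)

≼-refl : {A : FSet n} → A ≼ A
≼-refl = record { card-≡ = refl ; sumset-≤ = ℕ.≤-refl }

≼-trans : {C : FSet d} {B : FSet m} {A : FSet n} → C ≼ B → B ≼ A → C ≼ A
≼-trans C≼B B≼A = record
  { card-≡   = trans (_≼_.card-≡ C≼B) (_≼_.card-≡ B≼A)
  ; sumset-≤ = ℕ.≤-trans (_≼_.sumset-≤ C≼B) (_≼_.sumset-≤ B≼A) }

downset-remove : {A : FSet n} → IsDownset A → ∀ k y → lookup y k ≡ true → y ∈ₛ A → (y ⊕ e k) ∈ₛ A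
downset-remove {A = A} down k y yₖ y∈A = down k (y ⊕ e k)
  (trans (lookup-flip-same y k) (cong not yₖ))
  (subst (_∈ₛ A) (sym (⊕-cancelʳ y (e k))) y∈A)

coordinateCompression : Fin n → Compression n
coordinateCompression i = record
  { u            = e i
  ; lower        = λ x → not (lookup x i)
  ; upper        = λ x → lookup x i
  ; upper-⊕      = λ x → lookup-flip-same x i
  ; lower⇒¬upper = λ _ → not-true⇒false }

module CoordinateCompression (i : Fin n) (A : FSet n) where
  open Compression (coordinateCompression i)

  spanning : Spanning A → Spanning (compress A)
  spanning (𝟎∈A , e∈A) = compress-keeps A 𝟎 𝟎∈A (lookup-𝟎 i) , e∈C
    where
    e∈C : ∀ k → e k ∈ₛ compress A
    e∈C k with i Fin.≟ k
    ... | yes refl = compress-both⁺ A (e i) (e∈A i) (subst (_∈ₛ A) (sym (⊕-self (e i))) 𝟎∈A)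
    ... | no i≢k   = compress-keeps A (e k) (e∈A k) (lookup-e-other i≢k)

  no-worse : compress A ≼ A
  no-worse = record
    { card-≡   = card-compress A
    ; sumset-≤ = card-sumset-compress A i (lookup-e-same i) doubled }
    where
    doubled : ∀ a → a ∈ₛ compress A → lookup a i ≡ true → a ∈ₛ A × (a ⊕ e i) ∈ₛ A
    doubled a a∈C aᵢ with h ← trans (sym (compress-high A aᵢ)) a∈C = ∧-conicalˡ _ _ h , ∧-conicalʳ _ _ h

  weight-decreases : ∀ x → lookup x i ≡ false → (x ⊕ e i) ∈ₛ A → A x ≡ false →
    weight (compress A) <ℕ weight A
  weight-decreases x xᵢ x⊕eᵢ∈A x∉A = weight-compress-< A lower-value-< (x ⊕ e i) x⊕eᵢ∈A
    (trans (lookup-flip-same x i) (cong not xᵢ))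
    (trans (cong A (⊕-cancelʳ x (e i))) x∉A)
    where
    lower-value-< : ∀ y → not (lookup y i) ≡ true → value y <ℕ value (y ⊕ e i)
    lower-value-< y yᵢ rewrite value-flip y i (not-true⇒false yᵢ) = ℕ.m<m+n (value y) (ℕ.m^n>0 2 (toℕ i))

module _ {i j : Fin n} (i≢j : i ≢ j) where

  lookup-flip₂-fst : (x : Pt n) → lookup (x ⊕ (e i ⊕ e j)) i ≡ not (lookup x i)
  lookup-flip₂-fst x = begin
    lookup (x ⊕ (e i ⊕ e j)) i  ≡⟨ cong (λ w → lookup w i) (⊕-assoc x (e i) (e j)) ⟨
    lookup ((x ⊕ e i) ⊕ e j) i  ≡⟨ lookup-flip-other (x ⊕ e i) i≢j ⟩
    lookup (x ⊕ e i) i          ≡⟨ lookup-flip-same x i ⟩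
    not (lookup x i)            ∎
    where open ≡-Reasoning

  lookup-flip₂-snd : (x : Pt n) → lookup (x ⊕ (e i ⊕ e j)) j ≡ not (lookup x j)
  lookup-flip₂-snd x = begin
    lookup (x ⊕ (e i ⊕ e j)) j  ≡⟨ cong (λ w → lookup w j) (⊕-assoc x (e i) (e j)) ⟨
    lookup ((x ⊕ e i) ⊕ e j) j  ≡⟨ lookup-flip-same (x ⊕ e i) j ⟩
    not (lookup (x ⊕ e i) j)    ≡⟨ cong not (lookup-flip-other x (i≢j ∘ sym)) ⟩
    not (lookup x j)            ∎
    where open ≡-Reasoning

  shiftCompression : Compression n
  shiftCompression = record
    { u            = e i ⊕ e j
    ; lower        = λ x → lookup x i ∧ not (lookup x j)
    ; upper        = λ x → not (lookup x i) ∧ lookup x j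
    ; upper-⊕      = λ x → cong₂ _∧_ (trans (cong not (lookup-flip₂-fst x)) (not-involutive _))
                                      (lookup-flip₂-snd x)
    ; lower⇒¬upper = λ x lx → cong (λ b → not b ∧ lookup x j) (∧-conicalˡ _ _ lx) }

module ShiftCompression {i j : Fin n} (i<j : i <ᶠ j) (A : FSet n) where
  i≢j : i ≢ j
  i≢j = Fin.<⇒≢ i<j

  open Compression (shiftCompression i≢j)

  spanning : Spanning A → Spanning (compress A)
  spanning (𝟎∈A , e∈A) = compress-keeps A 𝟎 𝟎∈A (not-upper 𝟎 (lookup-𝟎 j)) , e∈C
    where
    not-upper : ∀ x → lookup x j ≡ false → upper x ≡ false
    not-upper x xⱼ rewrite xⱼ = ∧-zeroʳ _
    e∈C : ∀ k → e k ∈ₛ compress A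
    e∈C k with j Fin.≟ k
    ... | yes refl = compress-both⁺ A (e j) (e∈A j) (subst (_∈ₛ A) (sym eⱼ⊕u≡eᵢ) (e∈A i))
      where
      eⱼ⊕u≡eᵢ : e j ⊕ (e i ⊕ e j) ≡ e i
      eⱼ⊕u≡eᵢ = trans (⊕-comm (e j) (e i ⊕ e j)) (⊕-cancelʳ (e i) (e j))
    ... | no j≢k   = compress-keeps A (e k) (e∈A k) (not-upper (e k) (lookup-e-other j≢k))

  no-worse : IsDownset A → compress A ≼ A
  no-worse down = record
    { card-≡   = card-compress A
    ; sumset-≤ = card-sumset-compress A j uⱼ doubled }
    where
    uⱼ : lookup (e i ⊕ e j) j ≡ true
    uⱼ = trans (lookup-⊕ (e i) (e j) j) (cong₂ _xor_ (lookup-e-other (i≢j ∘ sym)) (lookup-e-same j))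
    -- A point with aᵢ = aⱼ = 1 is left in place, and the downset property supplies a ⊕ u.
    doubled : ∀ a → a ∈ₛ compress A → lookup a j ≡ true → a ∈ₛ A × (a ⊕ (e i ⊕ e j)) ∈ₛ A
    doubled a a∈C aⱼ with lookup a i ≟ᵇ true
    ... | no aᵢ≢true with h ← trans (sym (compress-high A (cong₂ _∧_ (cong not (¬-not aᵢ≢true)) aⱼ))) a∈C =
          ∧-conicalˡ _ _ h , ∧-conicalʳ _ _ h
    ... | yes aᵢ = a∈A , subst (_∈ₛ A) (⊕-assoc a (e i) (e j))
                     (downset-remove down j (a ⊕ e i) (trans (lookup-flip-other a (i≢j ∘ sym)) aⱼ)
                       (downset-remove down i a aᵢ a∈A))
      where
      a∈A : a ∈ₛ A
      a∈A = trans (sym (compress-rest A (cong₂ _∧_ aᵢ (cong not aⱼ)) (cong₂ _∧_ (cong not aᵢ) aⱼ))) a∈C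

  weight-decreases : ∀ x → lookup x i ≡ false → lookup x j ≡ false → (x ⊕ e j) ∈ₛ A → A (x ⊕ e i) ≡ false →
    weight (compress A) <ℕ weight A
  weight-decreases x xᵢ xⱼ x⊕eⱼ∈A x⊕eᵢ∉A = weight-compress-< A lower-value-< (x ⊕ e j) x⊕eⱼ∈A
    (cong₂ _∧_ (cong not (trans (lookup-flip-other x i≢j) xᵢ)) (trans (lookup-flip-same x j) (cong not xⱼ)))
    (trans (cong A x⊕eⱼ⊕u≡x⊕eᵢ) x⊕eᵢ∉A)
    where
    x⊕eⱼ⊕u≡x⊕eᵢ : (x ⊕ e j) ⊕ (e i ⊕ e j) ≡ x ⊕ e i
    x⊕eⱼ⊕u≡x⊕eᵢ = begin
      (x ⊕ e j) ⊕ (e i ⊕ e j)  ≡⟨ cong ((x ⊕ e j) ⊕_) (⊕-comm (e i) (e j)) ⟩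
      (x ⊕ e j) ⊕ (e j ⊕ e i)  ≡⟨ ⊕-assoc (x ⊕ e j) (e j) (e i) ⟨
      ((x ⊕ e j) ⊕ e j) ⊕ e i  ≡⟨ cong (_⊕ e i) (⊕-cancelʳ x (e j)) ⟩
      x ⊕ e i                  ∎
      where open ≡-Reasoning
    lower-value-< : ∀ y → lookup y i ∧ not (lookup y j) ≡ true → value y <ℕ value (y ⊕ (e i ⊕ e j))
    lower-value-< y ly = subst₂ _<ℕ_ value-y value-y⊕u
        (ℕ.+-monoʳ-< (value z) (ℕ.^-monoʳ-< 2 (s≤s (s≤s z≤n)) i<j))
      where
      yᵢ : lookup y i ≡ true
      yᵢ = ∧-conicalˡ _ _ ly
      yⱼ : lookup y j ≡ false
      yⱼ = not-true⇒false (∧-conicalʳ _ _ ly)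
      z : Pt n
      z = y ⊕ e i
      value-y : value z + 2 ^ toℕ i ≡ value y
      value-y = trans (sym (value-flip z i (trans (lookup-flip-same y i) (cong not yᵢ))))
                      (cong value (⊕-cancelʳ y (e i)))
      value-y⊕u : value z + 2 ^ toℕ j ≡ value (y ⊕ (e i ⊕ e j))
      value-y⊕u = trans (sym (value-flip z j (trans (lookup-flip-other y (i≢j ∘ sym)) yⱼ)))
                        (cong value (⊕-assoc y (e i) (e j)))

downset? : (A : FSet n) →
  IsDownset A ⊎ ∃[ i ] ∃[ x ] lookup x i ≡ false × (x ⊕ e i) ∈ₛ A × A x ≡ false
downset? A = search-Fin λ i → search-Pt (check i)
  where
  check : ∀ i x → (lookup x i ≡ false → (x ⊕ e i) ∈ₛ A → x ∈ₛ A)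
                ⊎ (lookup x i ≡ false × (x ⊕ e i) ∈ₛ A × A x ≡ false)
  check i x with lookup x i | A (x ⊕ e i) | A x
  ... | true  | _     | _     = inj₁ λ ()
  ... | false | false | _     = inj₁ λ _ ()
  ... | false | true  | true  = inj₁ λ _ _ → refl
  ... | false | true  | false = inj₂ (refl , refl , refl)

shiftMinimal? : (A : FSet n) →
  IsShiftMinimal A ⊎ ∃[ i ] ∃[ j ] ∃[ x ]
    i <ᶠ j × lookup x i ≡ false × lookup x j ≡ false × (x ⊕ e j) ∈ₛ A × A (x ⊕ e i) ≡ false
shiftMinimal? A = search-Fin λ i → search-Fin λ j → search-Pt (check i j)
  where
  check : ∀ i j x →
    (i <ᶠ j → lookup x i ≡ false → lookup x j ≡ false → (x ⊕ e j) ∈ₛ A → (x ⊕ e i) ∈ₛ A)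
    ⊎ (i <ᶠ j × lookup x i ≡ false × lookup x j ≡ false × (x ⊕ e j) ∈ₛ A × A (x ⊕ e i) ≡ false)
  check i j x with i Fin.<? j | lookup x i | lookup x j | A (x ⊕ e j) | A (x ⊕ e i)
  ... | no i≮j  | _     | _     | _     | _     = inj₁ λ i<j → ⊥-elim (i≮j i<j)
  ... | yes _   | true  | _     | _     | _     = inj₁ λ _ ()
  ... | yes _   | false | true  | _     | _     = inj₁ λ _ _ ()
  ... | yes _   | false | false | false | _     = inj₁ λ _ _ _ ()
  ... | yes _   | false | false | true  | true  = inj₁ λ _ _ _ _ → refl
  ... | yes i<j | false | false | true  | false = inj₂ (i<j , refl , refl , refl , refl)

SMDReplacement : FSet n → Set
SMDReplacement {n} A = Σ[ B ∈ FSet n ] IsSMD B × Spanning B × B ≼ A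

-- Shift compressions are only applied to downsets, so they need not be shown to preserve
-- the downset property.
smdReplacement : (A : FSet n) → Spanning A → SMDReplacement A
smdReplacement A = go A (<-wellFounded (weight A))
  where
  via : {A B : FSet n} → B ≼ A → SMDReplacement B → SMDReplacement A
  via B≼A (C , smd , spanning , C≼B) = C , smd , spanning , ≼-trans C≼B B≼A

  go : (A : FSet n) → Acc _<ℕ_ (weight A) → Spanning A → SMDReplacement A
  go A (acc smaller) spanA with downset? A
  ... | inj₂ (i , x , xᵢ , x⊕eᵢ∈A , x∉A) =
        via no-worse (go _ (smaller (weight-decreases x xᵢ x⊕eᵢ∈A x∉A)) (spanning spanA))
    where open CoordinateCompression i A
  ... | inj₁ down with shiftMinimal? A
  ...   | inj₁ shift = A , (down , shift) , spanA , ≼-refl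
  ...   | inj₂ (i , j , x , i<j , xᵢ , xⱼ , x⊕eⱼ∈A , x⊕eᵢ∉A) =
          via (no-worse down) (go _ (smaller (weight-decreases x xᵢ xⱼ x⊕eⱼ∈A x⊕eᵢ∉A)) (spanning spanA))
    where open ShiftCompression i<j A

linComb : Vec (Pt n) d → Pt d → Pt n
linComb []       []      = 𝟎
linComb (v ∷ vs) (b ∷ y) = (if b then v else 𝟎) ⊕ linComb vs y

linComb-𝟎 : (vs : Vec (Pt n) d) → linComb vs 𝟎 ≡ 𝟎
linComb-𝟎 []       = refl
linComb-𝟎 (v ∷ vs) = trans (⊕-identityˡ _) (linComb-𝟎 vs)

linComb-e : (vs : Vec (Pt n) d) (k : Fin d) → linComb vs (e k) ≡ lookup vs k
linComb-e (v ∷ vs) zero    = trans (cong (v ⊕_) (linComb-𝟎 vs)) (⊕-identityʳ v)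
linComb-e (v ∷ vs) (suc k) = trans (⊕-identityˡ _) (linComb-e vs k)

linComb-⊕ : (vs : Vec (Pt n) d) (y y′ : Pt d) → linComb vs (y ⊕ y′) ≡ linComb vs y ⊕ linComb vs y′
linComb-⊕ []       []      []        = sym (⊕-identityˡ 𝟎)
linComb-⊕ (v ∷ vs) (b ∷ y) (b′ ∷ y′) = begin
  scale (b xor b′) ⊕ L (y ⊕ y′)          ≡⟨ cong₂ _⊕_ (scale-xor b b′) (linComb-⊕ vs y y′) ⟩
  (scale b ⊕ scale b′) ⊕ (L y ⊕ L y′)    ≡⟨ ⊕-interchange (scale b) (scale b′) (L y) (L y′) ⟩
  (scale b ⊕ L y) ⊕ (scale b′ ⊕ L y′)    ∎
  where
  open ≡-Reasoning
  L : Pt _ → Pt _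
  L = linComb vs
  scale : Bool → Pt _
  scale b = if b then v else 𝟎
  scale-xor : ∀ b b′ → scale (b xor b′) ≡ scale b ⊕ scale b′
  scale-xor true  true  = sym (⊕-self v)
  scale-xor true  false = sym (⊕-identityʳ v)
  scale-xor false b′    = sym (⊕-identityˡ (scale b′))

Independent : Vec (Pt n) d → Set
Independent vs = ∀ y y′ → linComb vs y ≡ linComb vs y′ → y ≡ y′

module _ {vs : Vec (Pt n) d} {v : Pt n} where

  private
    v-in-span : ∀ y y′ → v ⊕ linComb vs y ≡ 𝟎 ⊕ linComb vs y′ → linComb vs (y′ ⊕ y) ≡ v
    v-in-span y y′ eq = begin
      L (y′ ⊕ y)         ≡⟨ linComb-⊕ vs y′ y ⟩
      L y′ ⊕ L y         ≡⟨ cong (_⊕ L y) (trans (⊕-comm (L y) v) (trans eq (⊕-identityˡ (L y′)))) ⟨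
      (L y ⊕ v) ⊕ L y    ≡⟨ ⊕-swapʳ (L y) v (L y) ⟩
      (L y ⊕ L y) ⊕ v    ≡⟨ cong (_⊕ v) (⊕-self (L y)) ⟩
      𝟎 ⊕ v              ≡⟨ ⊕-identityˡ v ⟩
      v                  ∎
      where
      open ≡-Reasoning
      L : Pt d → Pt n
      L = linComb vs

  independent-∷ : Independent vs → (∀ y → linComb vs y ≢ v) → Independent (v ∷ vs)
  independent-∷ indep ∉span (true ∷ y) (true ∷ y′) eq =
    cong (true ∷_) (indep y y′ (⊕-injectiveʳ v
      (trans (⊕-comm (linComb vs y) v) (trans eq (⊕-comm v (linComb vs y′))))))
  independent-∷ indep ∉span (false ∷ y) (false ∷ y′) eq =
    cong (false ∷_) (indep y y′ (trans (sym (⊕-identityˡ _)) (trans eq (⊕-identityˡ _))))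
  independent-∷ indep ∉span (true ∷ y) (false ∷ y′) eq = ⊥-elim (∉span (y′ ⊕ y) (v-in-span y y′ eq))
  independent-∷ indep ∉span (false ∷ y) (true ∷ y′) eq = ⊥-elim (∉span (y ⊕ y′) (v-in-span y′ y (sym eq)))

record AffineBasis (A : FSet n) (a₀ : Pt n) (xs : List (Pt n)) : Set where
  field
    dim         : ℕ
    basis       : Vec (Pt n) dim
    independent : Independent basis
    basis∈A     : ∀ k → (lookup basis k ⊕ a₀) ∈ₛ A
    spans       : All (λ x → x ∈ₛ A → ∃[ y ] linComb basis y ⊕ a₀ ≡ x) xs

module _ {A : FSet n} {a₀ : Pt n} {xs : List (Pt n)} (x : Pt n) (old : AffineBasis A a₀ xs) where
  open AffineBasis old

  private
    same-basis : (x ∈ₛ A → ∃[ y ] linComb basis y ⊕ a₀ ≡ x) → AffineBasis A a₀ (x ∷ xs)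
    same-basis x-spanned = record
      { dim = dim ; basis = basis ; independent = independent ; basis∈A = basis∈A
      ; spans = x-spanned All.∷ spans }

  affineBasis-∷ : AffineBasis A a₀ (x ∷ xs)
  affineBasis-∷ with A x in x∈A | ∃-Pt? (λ y → linComb basis y ≟ₚ x ⊕ a₀)
  ... | false | _            = same-basis λ x∈A′ → ⊥-elim (true≢false (trans (sym x∈A′) x∈A))
  ... | true  | yes (y , eq) = same-basis λ _ → y , trans (cong (_⊕ a₀) eq) (⊕-cancelʳ x a₀)
  ... | true  | no ∉span     = record
    { dim         = suc dim
    ; basis       = (x ⊕ a₀) ∷ basis
    ; independent = independent-∷ independent (λ y eq → ∉span (y , eq))
    ; basis∈A     = λ where
        zero    → trans (cong A (⊕-cancelʳ x a₀)) x∈A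
        (suc k) → basis∈A k
    ; spans       = (λ _ → e zero , x-spanned) All.∷ All.map lift spans }
    where
    x-spanned : linComb ((x ⊕ a₀) ∷ basis) (e zero) ⊕ a₀ ≡ x
    x-spanned = trans (cong (_⊕ a₀) (linComb-e ((x ⊕ a₀) ∷ basis) zero)) (⊕-cancelʳ x a₀)
    lift : ∀ {x′} → (x′ ∈ₛ A → ∃[ y ] linComb basis y ⊕ a₀ ≡ x′) →
                    (x′ ∈ₛ A → ∃[ y ] linComb ((x ⊕ a₀) ∷ basis) y ⊕ a₀ ≡ x′)
    lift spanned x′∈A with y , eq ← spanned x′∈A = false ∷ y , trans (cong (_⊕ a₀) (⊕-identityˡ _)) eq

affineBasis : (A : FSet n) (a₀ : Pt n) (xs : List (Pt n)) → AffineBasis A a₀ xs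
affineBasis A a₀ []       = record
  { dim = 0 ; basis = [] ; independent = λ { [] [] _ → refl } ; basis∈A = λ () ; spans = All.[] }
affineBasis A a₀ (x ∷ xs) = affineBasis-∷ x (affineBasis A a₀ xs)

module _ (f : Pt d → Pt n) where

  preimage : Pt n → Pt d
  preimage x with ∃-Pt? (λ y → f y ≟ₚ x)
  ... | yes (y , _) = y
  ... | no _        = 𝟎

  preimage-correct : ∀ {x} y → f y ≡ x → f (preimage x) ≡ x
  preimage-correct {x} y fy≡x with ∃-Pt? (λ y → f y ≟ₚ x)
  ... | yes (_ , eq) = eq
  ... | no ∄y        = ⊥-elim (∄y (y , fy≡x))

  image : FSet n
  image x = isYes (f (preimage x) ≟ₚ x)

  image⁺ : ∀ {x} y → f y ≡ x → x ∈ₛ image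
  image⁺ y fy≡x = Equivalence.to T-≡ (fromWitness (preimage-correct y fy≡x))

  image⁻ : ∀ {x} → x ∈ₛ image → f (preimage x) ≡ x
  image⁻ x∈im = toWitness (Equivalence.from T-≡ x∈im)

image-subspace : (vs : Vec (Pt n) d) → IsSubspace (image (linComb vs))
image-subspace vs = record
  { zero∈    = image⁺ (linComb vs) 𝟎 (linComb-𝟎 vs)
  ; ⊕-closed = λ x y x∈ y∈ → image⁺ (linComb vs) (preimage (linComb vs) x ⊕ preimage (linComb vs) y)
      (trans (linComb-⊕ vs _ _) (cong₂ _⊕_ (image⁻ (linComb vs) x∈) (image⁻ (linComb vs) y∈))) }

subspace-full : {W : FSet n} → IsSubspace W → (∀ k → e k ∈ₛ W) → ∀ x → x ∈ₛ W
subspace-full {zero}      W-sub _   []      = IsSubspace.zero∈ W-sub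
subspace-full {suc n} {W} W-sub e∈W (b ∷ x) = with-head b
  where
  open IsSubspace W-sub
  tail-subspace : IsSubspace (λ z → W (false ∷ z))
  tail-subspace = record { zero∈ = zero∈ ; ⊕-closed = λ y z → ⊕-closed (false ∷ y) (false ∷ z) }
  x∈W : (false ∷ x) ∈ₛ W
  x∈W = subspace-full tail-subspace (e∈W ∘ suc) x
  with-head : ∀ b → (b ∷ x) ∈ₛ W
  with-head false = x∈W
  with-head true  = subst (_∈ₛ W) (cong (true ∷_) (⊕-identityˡ x))
                      (⊕-closed (e zero) (false ∷ x) (e∈W zero) x∈W)

affine-full : {V : FSet n} {B : FSet n} → IsAffineSubspace V → Spanning B → B ⊆ₛ V → ∀ x → x ∈ₛ V
affine-full {V = V} (v , W , W-sub , V≡W⊕v) (𝟎∈B , e∈B) B⊆V x =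
  trans (V≡W⊕v x) (subspace-full W-sub e∈W (x ⊕ v))
  where
  open IsSubspace W-sub
  translate : ∀ {y} → y ∈ₛ V → (y ⊕ v) ∈ₛ W
  translate {y} y∈V = trans (sym (V≡W⊕v y)) y∈V
  v∈W : v ∈ₛ W
  v∈W = subst (_∈ₛ W) (⊕-identityˡ v) (translate (B⊆V 𝟎 𝟎∈B))
  e∈W : ∀ k → e k ∈ₛ W
  e∈W k = subst (_∈ₛ W) (⊕-cancelʳ (e k) v) (⊕-closed _ v (translate (B⊆V (e k) (e∈B k))) v∈W)

length-allPts : (n : ℕ) → length (allPts n) ≡ 2 ^ n
length-allPts zero    = refl
length-allPts (suc n) = begin
  length (map (false ∷_) (allPts n) ++ map (true ∷_) (allPts n))  ≡⟨ length-++ (map (false ∷_) (allPts n)) ⟩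
  length (map (false ∷_) (allPts n)) + length (map (true ∷_) (allPts n))
    ≡⟨ cong₂ _+_ (length-map (false ∷_) (allPts n)) (length-map (true ∷_) (allPts n)) ⟩
  length (allPts n) + length (allPts n)  ≡⟨ cong (λ k → k + k) (length-allPts n) ⟩
  2 ^ n + 2 ^ n                          ≡⟨ cong (2 ^ n +_) (ℕ.+-identityʳ (2 ^ n)) ⟨
  2 * 2 ^ n                              ∎
  where open ≡-Reasoning

card-full : {V : FSet n} → (∀ x → x ∈ₛ V) → card V ≡ 2 ^ n
card-full {n} {V} full =
  trans (cong length (filter-all (λ x → V x ≟ᵇ true) (All.universal full (allPts n)))) (length-allPts n)

-- A is affinely isomorphic to a spanning subset B of F₂^dim; V is the image of F₂^dim.
record SpanningModel (A : FSet n) : Set where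
  field
    dim      : ℕ
    B        : FSet dim
    spanning : Spanning B
    B≼A      : B ≼ A
    V        : FSet n
    V-affine : IsAffineSubspace V
    A⊆V      : A ⊆ₛ V
    card-V   : card V ≤ℕ 2 ^ dim

spanningModel : (A : FSet n) → NonEmpty A → SpanningModel A
spanningModel {n} A (a₀ , a₀∈A) = record
  { dim      = dim
  ; B        = A ∘ φ
  ; spanning = trans (cong (λ z → A (z ⊕ a₀)) (linComb-𝟎 basis)) (trans (cong A (⊕-identityˡ a₀)) a₀∈A)
             , λ k → trans (cong (λ z → A (z ⊕ a₀)) (linComb-e basis k)) (basis∈A k)
  ; B≼A      = record { card-≡ = card-B ; sumset-≤ = card-sumset-B }
  ; V        = λ x → image L (x ⊕ a₀)
  ; V-affine = a₀ , image L , image-subspace basis , λ _ → refl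
  ; A⊆V      = λ x x∈A → image⁺ L (proj₁ (spanned x∈A)) (⊕-moveʳ a₀ (proj₂ (spanned x∈A)))
  ; card-V   = card-V }
  where
  open AffineBasis (affineBasis A a₀ (allPts n))

  L : Pt dim → Pt n
  L = linComb basis

  φ : Pt dim → Pt n
  φ y = L y ⊕ a₀

  spanned : ∀ {x} → x ∈ₛ A → ∃[ y ] φ y ≡ x
  spanned {x} = All.lookup spans (allPts-complete x)

  card-B : card (A ∘ φ) ≡ card A
  card-B = ℕ.≤-antisym
    (card-≤-injection φ (λ _ y∈B → y∈B) (λ y y′ _ _ eq → independent y y′ (⊕-injectiveʳ a₀ eq)))
    (card-≤-injection (preimage φ)
      (λ x x∈A → trans (cong A (φ∘preimage x∈A)) x∈A)
      (λ x x′ x∈A x′∈A eq → trans (sym (φ∘preimage x∈A)) (trans (cong φ eq) (φ∘preimage x′∈A))))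
    where
    φ∘preimage : ∀ {x} → x ∈ₛ A → φ (preimage φ x) ≡ x
    φ∘preimage x∈A = preimage-correct φ (proj₁ (spanned x∈A)) (proj₂ (spanned x∈A))

  card-sumset-B : card (sumset (A ∘ φ)) ≤ℕ card (sumset A)
  card-sumset-B = card-≤-injection L into (λ y y′ _ _ → independent y y′)
    where
    into : MapsTo L (sumset (A ∘ φ)) (sumset A)
    into z z∈B+B with a , b , a∈B , b∈B , refl ← sumset⁻ (A ∘ φ) z∈B+B =
      sumset⁺ A a∈B b∈B (trans (⊕-cancel-both (L a) (L b) a₀) (sym (linComb-⊕ basis a b)))

  card-V : card (λ x → image L (x ⊕ a₀)) ≤ℕ 2 ^ dim
  card-V = ℕ.≤-trans
    (card-≤-injection {Y = λ _ → true} (λ x → preimage L (x ⊕ a₀)) (λ _ _ → refl)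
      (λ x x′ x∈V x′∈V eq → ⊕-injectiveʳ a₀
        (trans (sym (image⁻ L x∈V)) (trans (cong L eq) (image⁻ L x′∈V)))))
    (ℕ.≤-reflexive (card-full {dim} (λ _ → refl)))

ℕ→ℚ-mono-≤ : {k m : ℕ} → k ≤ℕ m → ℕ→ℚ k ≤ ℕ→ℚ m
ℕ→ℚ-mono-≤ {k} {m} k≤m
  rewrite ℚ.normalize-coprime {k} {0} (Coprime.sym (Coprime.1-coprimeTo k))
        | ℚ.normalize-coprime {m} {0} (Coprime.sym (Coprime.1-coprimeTo m))
  = *≤* (ℤ.*-monoʳ-≤-nonNeg (ℤ.+ 1) (ℤ.+≤+ k≤m))

doubling-≼ : {B : FSet m} {A : FSet n} (K : ℚ) → B ≼ A → DoublingAtMost A K → DoublingAtMost B K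
doubling-≼ {B = B} {A} K B≼A σA≤K = begin
  ℕ→ℚ (card (sumset B))  ≤⟨ ℕ→ℚ-mono-≤ sumset-≤ ⟩
  ℕ→ℚ (card (sumset A))  ≤⟨ σA≤K ⟩
  K *ℚ ℕ→ℚ (card A)      ≡⟨ cong (λ k → K *ℚ ℕ→ℚ k) card-≡ ⟨
  K *ℚ ℕ→ℚ (card B)      ∎
  where
  open _≼_ B≼A
  open ℚ.≤-Reasoning

module _ (K C : ℚ) (H : Admissible IsSMD K C) {A : FSet n} (model : SpanningModel A) where
  open SpanningModel model

  model-bound : DoublingAtMost A K → ℕ→ℚ (card V) ≤ C *ℚ ℕ→ℚ (card A)
  model-bound σA≤K =
    let B′ , B′-smd , B′-spanning , B′≼B = smdReplacement B spanning
        B′≼A = ≼-trans B′≼B B≼A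
        V′ , V′-affine , B′⊆V′ , |V′|≤C|B′| =
          H dim B′ B′-smd (𝟎 , proj₁ B′-spanning) (doubling-≼ K B′≼A σA≤K)
    in begin
    ℕ→ℚ (card V)        ≤⟨ ℕ→ℚ-mono-≤ card-V ⟩
    ℕ→ℚ (2 ^ dim)       ≡⟨ cong ℕ→ℚ (card-full (affine-full V′-affine B′-spanning B′⊆V′)) ⟨
    ℕ→ℚ (card V′)       ≤⟨ |V′|≤C|B′| ⟩
    C *ℚ ℕ→ℚ (card B′)  ≡⟨ cong (λ k → C *ℚ ℕ→ℚ k) (_≼_.card-≡ B′≼A) ⟩
    C *ℚ ℕ→ℚ (card A)   ∎
    where open ℚ.≤-Reasoning

admissible-SMD⇒all : (K C : ℚ) → Admissible IsSMD K C → Admissible AllSets K C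
admissible-SMD⇒all K C H n A _ A≢∅ σA≤K = V , V-affine , A⊆V , model-bound K C H model σA≤K
  where
  model : SpanningModel A
  model = spanningModel A A≢∅
  open SpanningModel model

lemma1p8 : (K : ℚ) → 1ℚ ≤ K → (C : ℚ) →
    (Admissible AllSets K C ⇔ Admissible IsDownset K C) ×
    (Admissible IsDownset K C ⇔ Admissible IsSMD K C)
-- The reduction to SMDs works for every K.
lemma1p8 K _ C =
  mk⇔ (restrict (λ _ → tt)) (admissible-SMD⇒all K C ∘ restrict proj₁) ,
  mk⇔ (restrict proj₁) (restrict (λ _ → tt) ∘ admissible-SMD⇒all K C)
  where
  restrict : {P Q : Class} → (∀ {n} {A : FSet n} → Q A → P A) → Admissible P K C → Admissible Q K C
  restrict Q⇒P H n A = H n A ∘ Q⇒P
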